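{- Let $\langle M,+,\cdot\rangle$ be a topological model of ${\rm PA}^-$. Then $M$ is upward homogeneous: whenever $a<b$ in $M$, there is a continuous injection $f:M\to M$ with $f(a)=b$. In particular, if $b$ is an isolated point of $M$, then every $a<b$ is also isolated.
   Context: ${\rm PA}^-$ is the theory of the non-negative parts of discretely ordered rings (Peano arithmetic without induction); $<$ is the order of the model. A topological model of ${\rm PA}^-$ is a topological space $M$ with operations $+,\cdot:M\times M\to M$ continuous in the product topology such that $\langle M,+,\cdot\rangle\models{\rm PA}^-$. -}

module Defs where

open import Data.Product using (Σ; _×_; _,_)
open import Data.Sum using (_⊎_)
open import Data.Empty using (⊥)
open import Data.Unit using (⊤)
open import Relation.Nullary using (¬_)
open import Relation.Binary.PropositionalEquality using (_≡_)

record Topology (M : Set) : Set₁ where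
  field
    IsOpen   : (M → Set) → Set
    ext      : (U V : M → Set) → (∀ x → U x → V x) → (∀ x → V x → U x) →
               IsOpen U → IsOpen V
    univ     : IsOpen (λ _ → ⊤)
    union    : (I : Set) (U : I → M → Set) → (∀ i → IsOpen (U i)) →
               IsOpen (λ x → Σ I (λ i → U i x))
    inter    : (U V : M → Set) → IsOpen U → IsOpen V →
               IsOpen (λ x → U x × V x)

open Topology public

Continuous : {M : Set} → Topology M → (M → M) → Set₁
Continuous τ f = (U : _ → Set) → IsOpen τ U → IsOpen τ (λ x → U (f x))

-- Continuity of a binary operation M × M → M in the product topology:
-- the preimage of each open set is open in the product topology, i.e. every
-- point of it has a basic open box U × V neighbourhood inside it.
Continuous₂ : {M : Set} → Topology M → (M → M → M) → Set₁
Continuous₂ {M} τ g =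
  (W : M → Set) → IsOpen τ W → (x y : M) → W (g x y) →
  Σ (M → Set) λ U → Σ (M → Set) λ V →
    IsOpen τ U × IsOpen τ V × U x × V y ×
    ((x' y' : M) → U x' → V y' → W (g x' y'))

Injective : {M : Set} → (M → M) → Set
Injective f = ∀ x y → f x ≡ f y → x ≡ y

Isolated : {M : Set} → Topology M → M → Set
Isolated τ b = IsOpen τ (λ x → x ≡ b)

-- Models of PA⁻ (Kaye's axiomatization: non-negative parts of discretely
-- ordered rings), in the language 0, 1, +, ·, <.
record PAminus (M : Set) : Set₁ where
  field
    _+_ _·_ : M → M → M
    𝟘 𝟙     : M
    _<_     : M → M → Set
    +-assoc : ∀ x y z → (x + y) + z ≡ x + (y + z)
    +-comm  : ∀ x y → x + y ≡ y + x
    ·-assoc : ∀ x y z → (x · y) · z ≡ x · (y · z)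
    ·-comm  : ∀ x y → x · y ≡ y · x
    distrib : ∀ x y z → x · (y + z) ≡ (x · y) + (x · z)
    +-zero  : ∀ x → x + 𝟘 ≡ x
    ·-zero  : ∀ x → x · 𝟘 ≡ 𝟘
    ·-one   : ∀ x → x · 𝟙 ≡ x
    irrefl  : ∀ x → ¬ (x < x)
    trans   : ∀ x y z → x < y → y < z → x < z
    trichot : ∀ x y → (x < y) ⊎ ((x ≡ y) ⊎ (y < x))
    +-mono  : ∀ x y z → x < y → (x + z) < (y + z)
    ·-mono  : ∀ x y z → 𝟘 < z → x < y → (x · z) < (y · z)
    sub     : ∀ x y → x < y → Σ M (λ z → x + z ≡ y)
    zero<one : 𝟘 < 𝟙
    discrete : ∀ x → 𝟘 < x → (𝟙 ≡ x) ⊎ (𝟙 < x)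
    nonneg   : ∀ x → (𝟘 ≡ x) ⊎ (𝟘 < x)

open PAminus public

record TopPAminus : Set₂ where
  field
    Carrier : Set
    topology : Topology Carrier
    model    : PAminus Carrier
    +-cont   : Continuous₂ topology (_+_ model)
    ·-cont   : Continuous₂ topology (_·_ model)

open TopPAminus public

module Submission where

-- If a < b then b = a + c for some c (axiom `sub`), and the translation
-- x ↦ x + c is the required map f with f a = b:
--   * it is continuous, because any operation that is jointly continuous
--     in the product topology is continuous in each argument separately
--     (`section-continuous`);
--   * it is injective, because it is strictly increasing (`+-mono`) and a
--     strictly increasing map of a strict linear order is injective
--     (`strictlyMonotone⇒injective`).
-- For the second claim, the preimage of the open singleton {b} under a
-- continuous injection f with f a = b is the singleton {a}, which is
-- therefore open (`isolated-preimage`).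

open import Defs
open import Data.Product using (Σ; _×_; _,_; proj₁)
open import Data.Sum using (inj₁; inj₂)
open import Data.Empty using (⊥-elim)
open import Relation.Binary.PropositionalEquality
  using (_≡_; refl; subst; cong)

-- Fixing the second argument of an operation that is continuous in the
-- product topology gives a continuous unary map: the preimage of an open U
-- is the union of the first factors of the basic boxes around its points.
section-continuous : {M : Set} (τ : Topology M) (g : M → M → M) →
  Continuous₂ τ g → (c : M) → Continuous τ (λ x → g x c)
section-continuous {M} τ g g-cont c U U-open =
  ext τ boxUnion (λ x → U (g x c)) insidePreimage coversPreimage boxUnion-open
  where
    Point : Set
    Point = Σ M λ x → U (g x c)

    box : (p : Point) → Σ (M → Set) λ U' → Σ (M → Set) λ V →
      IsOpen τ U' × IsOpen τ V × U' (proj₁ p) × V c ×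
      ((x' y' : M) → U' x' → V y' → U (g x' y'))
    box (x , gxc∈U) = g-cont U U-open x c gxc∈U

    firstFactor : Point → M → Set
    firstFactor p = proj₁ (box p)

    boxUnion : M → Set
    boxUnion y = Σ Point λ p → firstFactor p y

    boxUnion-open : IsOpen τ boxUnion
    boxUnion-open = union τ Point firstFactor
      (λ p → let (_ , _ , open₁ , _) = box p in open₁)

    insidePreimage : ∀ y → boxUnion y → U (g y c)
    insidePreimage y (p , y∈box) with box p
    ... | _ , _ , _ , _ , _ , c∈V , boxInside = boxInside y c y∈box c∈V

    coversPreimage : ∀ y → U (g y c) → boxUnion y
    coversPreimage y gyc∈U =
      (y , gyc∈U) , let (_ , _ , _ , _ , y∈U' , _) = box (y , gyc∈U) in y∈U'

strictlyMonotone⇒injective : {M : Set} (P : PAminus M) (f : M → M) →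
  (∀ x y → _<_ P x y → _<_ P (f x) (f y)) → Injective f
strictlyMonotone⇒injective P f mono x y fx≡fy with trichot P x y
... | inj₁ x<y        = ⊥-elim (irrefl P (f y) (subst (λ z → _<_ P z (f y)) fx≡fy (mono x y x<y)))
... | inj₂ (inj₁ x≡y) = x≡y
... | inj₂ (inj₂ y<x) = ⊥-elim (irrefl P (f y) (subst (_<_ P (f y)) fx≡fy (mono y x y<x)))

-- Isolatedness is reflected by continuous injections: the preimage of the
-- open singleton {f a} under an injective f is exactly {a}.
isolated-preimage : {M : Set} (τ : Topology M) (f : M → M) →
  Continuous τ f → Injective f → (a : M) →
  Isolated τ (f a) → Isolated τ a
isolated-preimage τ f f-cont f-inj a fa-isolated =
  ext τ (λ x → f x ≡ f a) (λ x → x ≡ a)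
    (λ x fx≡fa → f-inj x a fx≡fa)
    (λ x x≡a → cong f x≡a)
    (f-cont (λ y → y ≡ f a) fa-isolated)

translation-continuous-injective : (𝕄 : TopPAminus) (c : Carrier 𝕄) →
  let f = λ x → _+_ (model 𝕄) x c in
  Continuous (topology 𝕄) f × Injective f
translation-continuous-injective 𝕄 c =
    section-continuous (topology 𝕄) (_+_ P) (+-cont 𝕄) c
  , strictlyMonotone⇒injective P (λ x → _+_ P x c) (λ x y x<y → +-mono P x y c x<y)
  where
    P = model 𝕄

mainTheorem15 : (𝕄 : TopPAminus) →
    ((a b : Carrier 𝕄) → _<_ (model 𝕄) a b →
    Σ (Carrier 𝕄 → Carrier 𝕄) λ f →
    Continuous (topology 𝕄) f × Injective f × (f a ≡ b))
    × ((a b : Carrier 𝕄) → _<_ (model 𝕄) a b →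
    Isolated (topology 𝕄) b → Isolated (topology 𝕄) a)
mainTheorem15 𝕄 = homogeneous , isolatedDownward
  where
    P = model 𝕄
    τ = topology 𝕄

    homogeneous : (a b : Carrier 𝕄) → _<_ P a b →
      Σ (Carrier 𝕄 → Carrier 𝕄) λ f → Continuous τ f × Injective f × (f a ≡ b)
    homogeneous a b a<b with sub P a b a<b
    ... | c , a+c≡b with translation-continuous-injective 𝕄 c
    ...   | cont , inj = (λ x → _+_ P x c) , cont , inj , a+c≡b

    isolatedDownward : (a b : Carrier 𝕄) → _<_ P a b → Isolated τ b → Isolated τ a
    isolatedDownward a b a<b b-isolated with homogeneous a b a<b
    ... | f , cont , inj , refl = isolated-preimage τ f cont inj a b-isolated
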